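{- Let $n$ be an even positive integer and let $\xi=a_1\cdots a_i a_{i+1}\cdots a_{n-1}n$ be a permutation of $[n]$ with last entry $n$ which is not parity alternating, and such that $a_{i+1}\cdots a_{n-1}n$ is a maximal PAP sequence of $\xi$. Then the permutations $\xi,\tau\xi,\dots,\tau^{n-i-1}\xi$ all have the same parity, the first entries of $\tau\xi,\tau^2\xi,\dots,\tau^{n-i-1}\xi$ are all odd, the permutation $\tau^{n-i}\xi$ has parity different from that of $\xi$, and the first entry of $\tau^{n-i}\xi$ is even.
   Context: Permutations of $[n]=\{1,\dots,n\}$ are written in one-line notation. A permutation $a_1\cdots a_n$ is parity alternating if $a_j,a_{j+1}$ have different parities for all $1\le j\le n-1$. A PAP sequence of $a_1\cdots a_n$ is a consecutive block $a_{r+1}\cdots a_s$ in which consecutive entries have different parities; it is maximal if it cannot be extended by an adjacent entry on either side (where such an entry exists) to a longer PAP sequence. An inversion is a pair $(j,l)$, $j<l$, with $a_j>a_l$; the parity of a permutation is the parity of its number of inversions. The operator $\sigma$ on permutations of $[n]$: (a) if $n$ is neither $a_1$ nor $a_n$, $\sigma(a_1\cdots a_n)=b_1\cdots b_n$ with $b_j=a_j+1$, except that the entry $n+1$ is replaced by $1$ in its position; (b) if $a_n=n$, $\sigma(a_1\cdots a_{n-1}n)=1\,b_1\cdots b_{n-1}$ with $b_j=a_j+1$; (c) if $a_1=n$, $\sigma(na_1\cdots a_{n-1})=b_1\cdots b_{n-1}\,1$ with $b_j=a_j+1$. For $\xi=a_1\cdots a_{n-1}n$ (last entry $n$), $\tau\xi=\sigma^{\,n-a_{n-1}}\xi$,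 the $(n-a_{n-1})$-fold application of $\sigma$; $\tau\xi$ again has last entry $n$, and $\tau^\ell$ denotes $\ell$-fold application of $\tau$. -}

module Defs where

open import Data.Nat using (ℕ; zero; suc; _+_; _∸_; _≡ᵇ_; _<ᵇ_; _%_; _≤_; _<_)
open import Data.Bool using (Bool; true; false; if_then_else_)
open import Data.List using (List; []; _∷_; _++_; map; length; take; drop; reverse)
open import Data.Product using (_×_; Σ)
open import Data.Empty using (⊥)
open import Data.Unit using (⊤)
open import Data.Maybe using (Maybe; just; nothing)
open import Relation.Binary.PropositionalEquality using (_≡_; _≢_)
open import Relation.Nullary using (¬_)

-- Permutations of [n] are lists of naturals in one-line notation.

par : ℕ → ℕ
par a = a % 2

PAP : List ℕ → Set
PAP []           = ⊤
PAP (x ∷ [])     = ⊤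
PAP (x ∷ y ∷ ys) = (par x ≢ par y) × PAP (y ∷ ys)

ParityAlternating : List ℕ → Set
ParityAlternating = PAP

-- the consecutive block a_{r+1} ... a_s (1-based indices) of xs
block : List ℕ → ℕ → ℕ → List ℕ
block xs r s = take (s ∸ r) (drop r xs)

MaximalPAP : List ℕ → ℕ → ℕ → Set
MaximalPAP xs r s =
  (r < s) × (s ≤ length xs) × PAP (block xs r s)
  × ((1 ≤ r) → ¬ PAP (block xs (r ∸ 1) s))
  × ((s < length xs) → ¬ PAP (block xs r (suc s)))

countLess : ℕ → List ℕ → ℕ
countLess x []       = 0
countLess x (y ∷ ys) = (if y <ᵇ x then 1 else 0) + countLess x ys

inversions : List ℕ → ℕ
inversions []       = 0
inversions (x ∷ xs) = countLess x xs + inversions xs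

parity : List ℕ → ℕ
parity xs = inversions xs % 2

-- the operator σ on permutations of [n]
-- (case (c): first entry n; case (b): last entry n; case (a): otherwise)
initList : List ℕ → List ℕ
initList xs = reverse (drop 1 (reverse xs))

lastEntry : List ℕ → ℕ
lastEntry xs with reverse xs
... | []    = 0
... | y ∷ _ = y

σ : ℕ → List ℕ → List ℕ
σ n [] = []
σ n (x ∷ xs) =
  if x ≡ᵇ n then map suc xs ++ (1 ∷ [])
  else if lastEntry (x ∷ xs) ≡ᵇ n then 1 ∷ map suc (initList (x ∷ xs))
  else map (λ a → if a ≡ᵇ n then 1 else suc a) (x ∷ xs)

iter : (List ℕ → List ℕ) → ℕ → List ℕ → List ℕ
iter f zero    xs = xs
iter f (suc k) xs = f (iter f k xs)

secondLast : List ℕ → ℕ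
secondLast xs with reverse xs
... | _ ∷ y ∷ _ = y
... | _         = 0

τ : ℕ → List ℕ → List ℕ
τ n ξ = iter (σ n) (n ∸ secondLast ξ) ξ

τ^ : ℕ → ℕ → List ℕ → List ℕ
τ^ n ℓ = iter (τ n) ℓ

FirstEntry : (ℕ → Set) → List ℕ → Set
FirstEntry P []      = ⊥
FirstEntry P (x ∷ _) = P x

Odd Even : ℕ → Set
Odd a  = a % 2 ≡ 1
Even a = a % 2 ≡ 0

module Submission where

-- Encode the parities of a₁ ⋯ aₙ by the cyclic word of parity jumps between cyclically
-- adjacent entries. As n is even, adding 1 to every entry modulo n preserves all jumps, so σ only
-- rotates this word and τ rotates it by exactly one place. The jump n a₁ is the parity of a₁ and
-- the jump aₙ₋₁ n that of aₙ₋₁; for ξ the word reads ⋯ 0 1ⁿ⁻ⁱ⁻¹ ending at aₙ₋₁ n, the 0 being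
-- the jump aᵢ aᵢ₊₁ that stops the maximal PAP sequence. On inversions, σ in case (b) changes
-- nothing and in case (a) changes the count by an amount ≡ n − 1, which is odd; hence
-- τ = σ^(n−aₙ₋₁) changes the parity of a permutation iff aₙ₋₁ is even. Rotating the word one place
-- per application of τ gives the claims.

open import Defs
open import Data.Bool using (true; false; T; if_then_else_)
open import Data.Bool.Properties using (T-≡)
open import Data.Empty using (⊥-elim)
open import Data.List using (List; []; _∷_; _++_; map; length; reverse; replicate; upTo; take; drop; last)
open import Data.List.Properties
open import Data.List.Relation.Unary.All as All using (All; []; _∷_)
open import Data.List.Relation.Unary.All.Properties using (++⁻ˡ; ++⁻ʳ; all-upTo)
  renaming (map⁺ to All-map⁺)
open import Data.List.Relation.Binary.Permutation.Propositional
  using (_↭_; ↭-sym; ↭-trans; prep; module PermutationReasoning)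
open import Data.List.Relation.Binary.Permutation.Propositional.Properties
  using (All-resp-↭; ∈-resp-↭; ↭-length; drop-mid; map⁺; ∷↭∷ʳ)
open import Data.List.Membership.Propositional using (_∈_)
open import Data.List.Membership.Propositional.Properties using (∈-∃++; ∈-++⁺ʳ)
open import Data.List.Relation.Unary.Any using (here)
open import Data.Maybe using (just)
open import Data.Nat using (ℕ; zero; suc; _+_; _*_; _∸_; _≤_; _<_; _%_; _≡ᵇ_; _<ᵇ_; _≟_; z≤n; s≤s; s≤s⁻¹; z<s; s<s)
open import Data.Nat.DivMod using (m%n<n; %-distribˡ-+; [m+kn]%n≡m%n)
open import Data.Nat.Properties
open import Data.Nat.Tactic.RingSolver using (solve-∀)
open import Data.Product using (_×_; _,_; proj₁; proj₂; ∃; ∃₂)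
open import Data.Sum using (_⊎_; inj₁; inj₂)
open import Function.Bundles using (Equivalence)
open import Relation.Binary.PropositionalEquality
open import Relation.Nullary using (¬_; yes; no)

<ᵇ-true : ∀ {m n} → m < n → (m <ᵇ n) ≡ true
<ᵇ-true m<n = Equivalence.to T-≡ (<⇒<ᵇ m<n)

<ᵇ-false : ∀ {m n} → n ≤ m → (m <ᵇ n) ≡ false
<ᵇ-false {m} {n} n≤m with m <ᵇ n in eq
... | false = refl
... | true  = ⊥-elim (≤⇒≯ n≤m (<ᵇ⇒< m n (subst T (sym eq) _)))

≡ᵇ-refl : ∀ m → (m ≡ᵇ m) ≡ true
≡ᵇ-refl m = Equivalence.to T-≡ (≡⇒≡ᵇ m m refl)

≡ᵇ-false : ∀ {m n} → m ≢ n → (m ≡ᵇ n) ≡ false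
≡ᵇ-false {m} {n} m≢n with m ≡ᵇ n in eq
... | false = refl
... | true  = ⊥-elim (m≢n (≡ᵇ⇒≡ m n (subst T (sym eq) _)))

par-cases : ∀ a → par a ≡ 0 ⊎ par a ≡ 1
par-cases a with par a | m%n<n a 2
... | 0           | _               = inj₁ refl
... | 1           | _               = inj₂ refl
... | suc (suc _) | s≤s (s≤s ())

par-+-cong : ∀ {a b c d} → par a ≡ par b → par c ≡ par d → par (a + c) ≡ par (b + d)
par-+-cong {a} {b} {c} {d} a≡b c≡d = begin
  par (a + c)         ≡⟨ %-distribˡ-+ a c 2 ⟩
  par (par a + par c) ≡⟨ cong₂ (λ x y → par (x + y)) a≡b c≡d ⟩
  par (par b + par d) ≡⟨ %-distribˡ-+ b d 2 ⟨
  par (b + d)         ∎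
  where open ≡-Reasoning

par-suc : ∀ {a b} → par a ≡ par b → par (suc a) ≡ par (suc b)
par-suc {a} {b} = par-+-cong {1} {1} {a} {b} refl

par-+-even : ∀ a b → par b ≡ 0 → par (a + b) ≡ par a
par-+-even a b b-even = trans (par-+-cong {a} {a} {b} {0} refl b-even) (cong par (+-identityʳ a))

par-+-odd : ∀ a b → par b ≡ 1 → par (a + b) ≢ par a
par-+-odd a b b-odd eq with par-cases a
... | inj₁ a-even = 0≢1+n (begin
  0           ≡⟨ a-even ⟨
  par a       ≡⟨ eq ⟨
  par (a + b) ≡⟨ par-+-cong {a} {0} {b} {1} a-even b-odd ⟩
  1           ∎)
  where open ≡-Reasoning
... | inj₂ a-odd = 0≢1+n (begin
  0           ≡⟨ par-+-cong {a} {1} {b} {1} a-odd b-odd ⟨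
  par (a + b) ≡⟨ eq ⟩
  par a       ≡⟨ a-odd ⟩
  1           ∎)
  where open ≡-Reasoning

par-+-double : ∀ a k → par (a + k * 2) ≡ par a
par-+-double a k = [m+kn]%n≡m%n a k 2

jump : ℕ → ℕ → ℕ
jump a b = par (a + b)

jump-comm : ∀ a b → jump a b ≡ jump b a
jump-comm a b = cong par (+-comm a b)

jump-suc : ∀ a b → jump (suc a) (suc b) ≡ jump a b
jump-suc a b = trans (cong par (trans (cong suc (+-suc a b)) (+-comm 2 (a + b)))) (par-+-even (a + b) 2 refl)

jump-same : ∀ a b → par a ≡ par b → jump a b ≡ 0
jump-same a b a≡b with par-cases b
... | inj₁ b-even = par-+-cong {a} {0} {b} {0} (trans a≡b b-even) b-even
... | inj₂ b-odd  = par-+-cong {a} {1} {b} {1} (trans a≡b b-odd) b-odd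

jump-differ : ∀ a b → par a ≢ par b → jump a b ≡ 1
jump-differ a b a≢b with par-cases a | par-cases b
... | inj₁ a-even | inj₁ b-even = ⊥-elim (a≢b (trans a-even (sym b-even)))
... | inj₁ a-even | inj₂ b-odd  = par-+-cong {a} {0} {b} {1} a-even b-odd
... | inj₂ a-odd  | inj₁ b-even = par-+-cong {a} {1} {b} {0} a-odd b-even
... | inj₂ a-odd  | inj₂ b-odd  = ⊥-elim (a≢b (trans a-odd (sym b-odd)))

jumps : List ℕ → List ℕ
jumps []           = []
jumps (x ∷ [])     = []
jumps (x ∷ y ∷ ys) = jump x y ∷ jumps (y ∷ ys)

lastOf : ℕ → List ℕ → ℕ
lastOf x []       = x
lastOf x (y ∷ ys) = lastOf y ys

initOf : ℕ → List ℕ → List ℕ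
initOf x []       = []
initOf x (y ∷ ys) = x ∷ initOf y ys

-- The cyclic word of parity jumps of a₁ ⋯ aₙ, read backwards starting from the jump aₙ a₁.
cyclicJumps : List ℕ → List ℕ
cyclicJumps []       = []
cyclicJumps (x ∷ xs) = jump (lastOf x xs) x ∷ reverse (jumps (x ∷ xs))

rotate : List ℕ → List ℕ
rotate []       = []
rotate (x ∷ xs) = xs ++ x ∷ []

initOf-++-lastOf : ∀ x ws → x ∷ ws ≡ initOf x ws ++ lastOf x ws ∷ []
initOf-++-lastOf x []       = refl
initOf-++-lastOf x (y ∷ ys) = cong (x ∷_) (initOf-++-lastOf y ys)

lastOf-∷ʳ : ∀ x ws y → lastOf x (ws ++ y ∷ []) ≡ y
lastOf-∷ʳ x []       y = refl
lastOf-∷ʳ x (w ∷ ws) y = lastOf-∷ʳ w ws y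

All-lastOf : ∀ {P : ℕ → Set} x ws → All P (x ∷ ws) → P (lastOf x ws)
All-lastOf x []       (px ∷ _)   = px
All-lastOf x (w ∷ ws) (_ ∷ pws) = All-lastOf w ws pws

lastOf-map : ∀ (g : ℕ → ℕ) x ws → lastOf (g x) (map g ws) ≡ g (lastOf x ws)
lastOf-map g x []       = refl
lastOf-map g x (w ∷ ws) = lastOf-map g w ws

jumps-∷ʳ : ∀ x ws y → jumps (x ∷ ws ++ y ∷ []) ≡ jumps (x ∷ ws) ++ jump (lastOf x ws) y ∷ []
jumps-∷ʳ x []       y = refl
jumps-∷ʳ x (w ∷ ws) y = cong (jump x w ∷_) (jumps-∷ʳ w ws y)

jumps-++ : ∀ xs y ys → jumps (xs ++ y ∷ ys) ≡ jumps (xs ++ y ∷ []) ++ jumps (y ∷ ys)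
jumps-++ []           y ys = refl
jumps-++ (x ∷ [])     y ys = refl
jumps-++ (x ∷ z ∷ zs) y ys = cong (jump x z ∷_) (jumps-++ (z ∷ zs) y ys)

module _ {g : ℕ → ℕ} (jump-g : ∀ a b → jump (g a) (g b) ≡ jump a b) where

  jumps-map : ∀ xs → jumps (map g xs) ≡ jumps xs
  jumps-map []           = refl
  jumps-map (x ∷ [])     = refl
  jumps-map (x ∷ y ∷ ys) = cong₂ _∷_ (jump-g x y) (jumps-map (y ∷ ys))

  cyclicJumps-map : ∀ xs → cyclicJumps (map g xs) ≡ cyclicJumps xs
  cyclicJumps-map []       = refl
  cyclicJumps-map (x ∷ xs) = cong₂ _∷_
    (trans (cong (λ z → jump z (g x)) (lastOf-map g x xs)) (jump-g _ x))
    (cong reverse (jumps-map (x ∷ xs)))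

cyclicJumps-∷ʳ : ∀ x ws y →
  cyclicJumps (x ∷ ws ++ y ∷ []) ≡ jump y x ∷ jump (lastOf x ws) y ∷ reverse (jumps (x ∷ ws))
cyclicJumps-∷ʳ x ws y = cong₂ _∷_ (cong (λ z → jump z x) (lastOf-∷ʳ x ws y))
  (trans (cong reverse (jumps-∷ʳ x ws y)) (reverse-++ (jumps (x ∷ ws)) (jump (lastOf x ws) y ∷ [])))

rotate-cyclicJumps : ∀ x ws y → rotate (cyclicJumps (x ∷ ws ++ y ∷ [])) ≡ cyclicJumps (y ∷ x ∷ ws)
rotate-cyclicJumps x ws y = trans (cong rotate (cyclicJumps-∷ʳ x ws y))
  (cong (jump (lastOf x ws) y ∷_) (sym (unfold-reverse (jump y x) (jumps (x ∷ ws)))))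

cyclicJumps-++ : ∀ xs a ys → ∃ λ w → cyclicJumps (xs ++ a ∷ ys) ≡ w ∷ reverse (jumps (xs ++ a ∷ ys))
cyclicJumps-++ []       a ys = _ , refl
cyclicJumps-++ (x ∷ xs) a ys = _ , refl

ones : ℕ → List ℕ
ones r = replicate r 1

Block : ℕ → ℕ → List ℕ → Set
Block w r W = ∃ λ t → W ≡ w ∷ ones r ++ 0 ∷ t

rotate-Block : ∀ {w r W} → Block w (suc r) W → Block 1 r (rotate W)
rotate-Block {w} {r} (t , refl) = t ++ w ∷ [] , cong (1 ∷_) (++-assoc (ones r) (0 ∷ t) (w ∷ []))

∸-suc : ∀ {m k} → k < m → m ∸ k ≡ suc (m ∸ suc k)
∸-suc k<m = +-∸-assoc 1 k<m

Block-resp-≡ : ∀ {w r r′ W} → r ≡ r′ → Block w r W → Block w r′ W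
Block-resp-≡ {w} {W = W} e = subst (λ r → Block w r W) e

reverse-ones : ∀ r → reverse (ones r) ≡ ones r
reverse-ones zero    = refl
reverse-ones (suc r) = begin
  reverse (1 ∷ ones r)       ≡⟨ unfold-reverse 1 (ones r) ⟩
  reverse (ones r) ++ 1 ∷ [] ≡⟨ cong (_++ 1 ∷ []) (reverse-ones r) ⟩
  ones r ++ 1 ∷ []           ≡⟨ ones-∷ʳ r ⟩
  1 ∷ ones r                 ∎
  where
  open ≡-Reasoning
  ones-∷ʳ : ∀ r → ones r ++ 1 ∷ [] ≡ 1 ∷ ones r
  ones-∷ʳ zero    = refl
  ones-∷ʳ (suc r) = cong (1 ∷_) (ones-∷ʳ r)

countLess-++ : ∀ x ys zs → countLess x (ys ++ zs) ≡ countLess x ys + countLess x zs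
countLess-++ x []       zs = refl
countLess-++ x (y ∷ ys) zs = trans (cong (c +_) (countLess-++ x ys zs)) (sym (+-assoc c (countLess x ys) _))
  where c = if y <ᵇ x then 1 else 0

countLess-map-suc : ∀ x ys → countLess (suc x) (map suc ys) ≡ countLess x ys
countLess-map-suc x []       = refl
countLess-map-suc x (y ∷ ys) = cong ((if y <ᵇ x then 1 else 0) +_) (countLess-map-suc x ys)

inversions-map-suc : ∀ ys → inversions (map suc ys) ≡ inversions ys
inversions-map-suc []       = refl
inversions-map-suc (y ∷ ys) = cong₂ _+_ (countLess-map-suc y ys) (inversions-map-suc ys)

countLess-zero : ∀ ys → countLess 0 ys ≡ 0
countLess-zero []       = refl
countLess-zero (y ∷ ys) = countLess-zero ys

countLess-all< : ∀ x ys → All (_< x) ys → countLess x ys ≡ length ys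
countLess-all< x []       []         = refl
countLess-all< x (y ∷ ys) (y<x ∷ ps) rewrite <ᵇ-true y<x = cong suc (countLess-all< x ys ps)

inversions-∷ʳ-max : ∀ m ys → All (_≤ m) ys → inversions (ys ++ m ∷ []) ≡ inversions ys
inversions-∷ʳ-max m []       []          = refl
inversions-∷ʳ-max m (y ∷ ys) (y≤m ∷ ps)
  rewrite countLess-++ y ys (m ∷ []) | <ᵇ-false {m} {y} y≤m | inversions-∷ʳ-max m ys ps
        | +-identityʳ (countLess y ys) = refl

inversions-1∷map-suc : ∀ m ys → All (_≤ m) ys → inversions (1 ∷ map suc ys) ≡ inversions (ys ++ m ∷ [])
inversions-1∷map-suc m ys ps
  rewrite inversions-∷ʳ-max m ys ps | countLess-map-suc 0 ys | countLess-zero ys = inversions-map-suc ys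

-- The entries after m lose their inversion with m, those before gain one with 1.
inversions-max→1 : ∀ m u v → All (λ a → 0 < a × a < m) u → All (_< m) v →
  inversions (map suc u ++ 1 ∷ map suc v) + length v ≡ inversions (u ++ m ∷ v) + length u
inversions-max→1 m [] v [] v<m
  rewrite countLess-map-suc 0 v | countLess-zero v | inversions-map-suc v | countLess-all< m v v<m
  = trans (+-comm (inversions v) (length v)) (sym (+-identityʳ _))
inversions-max→1 m (suc x ∷ u) v ((_ , x<m) ∷ u-bounds) v<m
  rewrite countLess-++ (suc (suc x)) (map suc u) (1 ∷ map suc v)
        | countLess-++ (suc x) u (m ∷ v)
        | countLess-map-suc (suc x) u | countLess-map-suc (suc x) v
        | <ᵇ-false {m} {suc x} (<⇒≤ x<m)
  = shift (countLess (suc x) u) (countLess (suc x) v) _ _ _ _ (inversions-max→1 m u v u-bounds v<m)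
  where
  shift : ∀ a b I J lu lv → I + lv ≡ J + lu → a + (1 + b) + I + lv ≡ a + (0 + b) + J + suc lu
  shift a b I J lu lv e = begin
    a + (1 + b) + I + lv      ≡⟨ reassocˡ a b I lv ⟩
    a + b + 1 + (I + lv)      ≡⟨ cong (a + b + 1 +_) e ⟩
    a + b + 1 + (J + lu)      ≡⟨ reassocʳ a b J lu ⟩
    a + (0 + b) + J + suc lu  ∎
    where
    open ≡-Reasoning
    reassocˡ : ∀ a b I lv → a + (1 + b) + I + lv ≡ a + b + 1 + (I + lv)
    reassocˡ = solve-∀
    reassocʳ : ∀ a b J lu → a + b + 1 + (J + lu) ≡ a + (0 + b) + J + suc lu
    reassocʳ = solve-∀

oneTo : ℕ → List ℕ
oneTo k = map suc (upTo k)

oneTo-∷ʳ : ∀ k → oneTo (suc k) ≡ oneTo k ++ suc k ∷ []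
oneTo-∷ʳ k = trans (cong (map suc) (sym (upTo-∷ʳ k))) (map-++ suc (upTo k) (k ∷ []))

oneTo-suc : ∀ k → oneTo (suc k) ≡ 1 ∷ map suc (oneTo k)
oneTo-suc k = cong (λ xs → 1 ∷ map suc xs) (sym (map-upTo suc k))

length-oneTo : ∀ k → length (oneTo k) ≡ k
length-oneTo k = trans (length-map suc (upTo k)) (length-upTo k)

all-oneTo : ∀ k → All (λ a → 0 < a × a < suc k) (oneTo k)
all-oneTo k = All-map⁺ (All.map (λ a<k → z<s , s<s a<k) (all-upTo k))

↭-oneTo-∷ʳ : ∀ {k} zs → zs ++ suc k ∷ [] ↭ oneTo (suc k) → zs ↭ oneTo k
↭-oneTo-∷ʳ {k} zs p = subst₂ _↭_ (++-identityʳ zs) (++-identityʳ (oneTo k))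
  (drop-mid zs (oneTo k) (subst (zs ++ suc k ∷ [] ↭_) (oneTo-∷ʳ k) p))

max∈oneTo : ∀ k → suc k ∈ oneTo (suc k)
max∈oneTo k = subst (suc k ∈_) (sym (oneTo-∷ʳ k)) (∈-++⁺ʳ (oneTo k) (here refl))

↭-oneTo-split : ∀ {k} xs → xs ↭ oneTo (suc k) →
  ∃₂ λ u v → xs ≡ u ++ suc k ∷ v × u ++ v ↭ oneTo k
↭-oneTo-split {k} xs p with ∈-∃++ (∈-resp-↭ (↭-sym p) (max∈oneTo k))
... | u , v , refl = u , v , refl , subst (u ++ v ↭_) (++-identityʳ (oneTo k))
  (drop-mid u (oneTo k) (subst (u ++ suc k ∷ v ↭_) (oneTo-∷ʳ k) p))

↭-oneTo-1∷map-suc : ∀ {k} zs → zs ↭ oneTo k → 1 ∷ map suc zs ↭ oneTo (suc k)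
↭-oneTo-1∷map-suc {k} zs p = subst (1 ∷ map suc zs ↭_) (sym (oneTo-suc k)) (prep 1 (map⁺ suc p))

last-∷ʳ : ∀ {c : ℕ} xs → last xs ≡ just c → ∃ λ ys → xs ≡ ys ++ c ∷ []
last-∷ʳ (x ∷ [])     refl = [] , refl
last-∷ʳ (x ∷ y ∷ ys) e    with last-∷ʳ (y ∷ ys) e
... | zs , eq = x ∷ zs , cong (x ∷_) eq

lastEntry-∷ʳ : ∀ xs y → lastEntry (xs ++ y ∷ []) ≡ y
lastEntry-∷ʳ xs y rewrite reverse-++ xs (y ∷ []) = refl

initList-∷ʳ : ∀ xs y → initList (xs ++ y ∷ []) ≡ xs
initList-∷ʳ xs y rewrite reverse-++ xs (y ∷ []) = reverse-involutive xs

reverse-∷ : ∀ x ws → reverse (x ∷ ws) ≡ lastOf x ws ∷ reverse (initOf x ws)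
reverse-∷ x ws = trans (cong reverse (initOf-++-lastOf x ws)) (reverse-++ (initOf x ws) (lastOf x ws ∷ []))

secondLast-∷ʳ : ∀ x ws y → secondLast (x ∷ ws ++ y ∷ []) ≡ lastOf x ws
secondLast-∷ʳ x ws y rewrite reverse-++ (x ∷ ws) (y ∷ []) | reverse-∷ x ws = refl

module Orbit (n' : ℕ) (n-even : Even (suc n')) where

  n : ℕ
  n = suc n'

  wrap : ℕ → ℕ
  wrap a = if a ≡ᵇ n then 1 else suc a

  wrap-≢ : ∀ {a} → a ≢ n → wrap a ≡ suc a
  wrap-≢ a≢n rewrite ≡ᵇ-false a≢n = refl

  wrap-n : wrap n ≡ 1
  wrap-n rewrite ≡ᵇ-refl n = refl

  map-wrap-< : ∀ {xs} → All (_< n) xs → map wrap xs ≡ map suc xs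
  map-wrap-< xs<n = map-cong-local (All.map (λ a<n → wrap-≢ (<⇒≢ a<n)) xs<n)

  par-wrap : ∀ a → par (wrap a) ≡ par (suc a)
  par-wrap a with a ≟ n
  ... | yes refl = trans (cong par wrap-n) (sym (par-+-even 1 n n-even))
  ... | no a≢n   = cong par (wrap-≢ a≢n)

  jump-wrap : ∀ a b → jump (wrap a) (wrap b) ≡ jump a b
  jump-wrap a b = trans (par-+-cong {wrap a} {suc a} {wrap b} {suc b} (par-wrap a) (par-wrap b)) (jump-suc a b)

  map-wrap-oneTo : map wrap (oneTo n) ↭ oneTo n
  map-wrap-oneTo = begin
    map wrap (oneTo n)                 ≡⟨ cong (map wrap) (oneTo-∷ʳ n') ⟩
    map wrap (oneTo n' ++ n ∷ [])      ≡⟨ map-++ wrap (oneTo n') (n ∷ []) ⟩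
    map wrap (oneTo n') ++ wrap n ∷ [] ≡⟨ cong₂ (λ xs x → xs ++ x ∷ []) (map-wrap-< (All.map proj₂ (all-oneTo n'))) wrap-n ⟩
    map suc (oneTo n') ++ 1 ∷ []       ↭⟨ ↭-sym (∷↭∷ʳ 1 (map suc (oneTo n'))) ⟩
    1 ∷ map suc (oneTo n')             ≡⟨ oneTo-suc n' ⟨
    oneTo n                            ∎
    where open PermutationReasoning

  ↭-wrap : ∀ {xs} → xs ↭ oneTo n → map wrap xs ↭ oneTo n
  ↭-wrap p = ↭-trans (map⁺ wrap p) map-wrap-oneTo

  -- n − 1 is odd, so the shift of the inversion number in inversions-max→1 is odd.
  inversions-wrap : ∀ xs → xs ↭ oneTo n → par (suc (inversions (map wrap xs))) ≡ par (inversions xs)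
  inversions-wrap xs p with ↭-oneTo-split xs p
  ... | u , v , refl , uv = begin
    par (suc A)                ≡⟨ par-+-double (suc A) (length v) ⟨
    par (suc A + length v * 2) ≡⟨ cong par count ⟩
    par (I + n)                ≡⟨ par-+-even I n n-even ⟩
    par I                      ∎
    where
    open ≡-Reasoning
    A = inversions (map wrap (u ++ n ∷ v))
    A′ = inversions (map suc u ++ 1 ∷ map suc v)
    I = inversions (u ++ n ∷ v)
    bounds = All-resp-↭ (↭-sym uv) (all-oneTo n')
    u-bounds = ++⁻ˡ u bounds
    v-bounds = All.map proj₂ (++⁻ʳ u bounds)
    wrapped : map wrap (u ++ n ∷ v) ≡ map suc u ++ 1 ∷ map suc v
    wrapped = trans (map-++ wrap u (n ∷ v))
      (cong₂ _++_ (map-wrap-< (All.map proj₂ u-bounds)) (cong₂ _∷_ wrap-n (map-wrap-< v-bounds)))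
    lengths : length u + length v ≡ n'
    lengths = trans (sym (length-++ u)) (trans (↭-length uv) (length-oneTo n'))
    regroup : ∀ a l → suc a + l * 2 ≡ (a + l) + suc l
    regroup = solve-∀
    count : suc A + length v * 2 ≡ I + n
    count = begin
      suc A + length v * 2              ≡⟨ cong (λ xs → suc (inversions xs) + length v * 2) wrapped ⟩
      suc A′ + length v * 2             ≡⟨ regroup A′ (length v) ⟩
      A′ + length v + suc (length v)    ≡⟨ cong (_+ suc (length v)) (inversions-max→1 n u v u-bounds v-bounds) ⟩
      I + length u + suc (length v)     ≡⟨ +-assoc I (length u) _ ⟩
      I + (length u + suc (length v))   ≡⟨ cong (I +_) (+-suc (length u) (length v)) ⟩
      I + suc (length u + length v)     ≡⟨ cong (λ l → I + suc l) lengths ⟩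
      I + n                             ∎

  σ-max-last : ∀ x ws → x ≢ n → σ n (x ∷ ws ++ n ∷ []) ≡ 1 ∷ map suc (x ∷ ws)
  σ-max-last x ws x≢n
    rewrite ≡ᵇ-false x≢n | lastEntry-∷ʳ (x ∷ ws) n | ≡ᵇ-refl n | initList-∷ʳ (x ∷ ws) n = refl

  σ-wrap : ∀ {xs a W b} → xs ≡ a ∷ W ++ b ∷ [] → a ≢ n → b ≢ n → σ n xs ≡ map wrap xs
  σ-wrap {a = a} {W} {b} refl a≢n b≢n rewrite ≡ᵇ-false a≢n | lastEntry-∷ʳ (a ∷ W) b | ≡ᵇ-false b≢n = refl

  data Anchored : List ℕ → Set where
    anchored : ∀ x ws → x ∷ ws ++ n ∷ [] ↭ oneTo n → Anchored (x ∷ ws ++ n ∷ [])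

  anchored-≡ : ∀ {ξ x ws} → ξ ≡ x ∷ ws ++ n ∷ [] → ξ ↭ oneTo n → Anchored ξ
  anchored-≡ refl p = anchored _ _ p

  anchored-last : ∀ {ξ} → ξ ↭ oneTo n → last ξ ≡ just n → Anchored ξ
  anchored-last {ξ} p e with last-∷ʳ ξ e
  ... | x ∷ ws , refl = anchored x ws p
  ... | []     , refl = ⊥-elim (0≢1+n (sym (subst (λ k → Even (suc k)) n'≡0 n-even)))
    where
    n'≡0 : n' ≡ 0
    n'≡0 = sym (suc-injective (trans (↭-length p) (length-oneTo n)))

  -- σ^(1+j) ξ on the way from ξ = a₁ ⋯ aₙ₋₁ n to τ ξ = σ^(n−s) ξ, where s = aₙ₋₁
  record Partial (ξ : List ℕ) (s j : ℕ) : Set where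
    field
      middle      : List ℕ
      shape       : iter (σ n) (suc j) ξ ≡ suc j ∷ middle ++ suc j + s ∷ []
      perm        : iter (σ n) (suc j) ξ ↭ oneTo n
      cyclic      : cyclicJumps (iter (σ n) (suc j) ξ) ≡ rotate (cyclicJumps ξ)
      parityShift : par (inversions (iter (σ n) (suc j) ξ) + j) ≡ par (inversions ξ)

  Partial-start : ∀ x ws → x ∷ ws ++ n ∷ [] ↭ oneTo n → Partial (x ∷ ws ++ n ∷ []) (lastOf x ws) 0
  Partial-start x ws p = record
    { middle      = map suc (initOf x ws)
    ; shape       = trans σξ (cong (1 ∷_) (trans (cong (map suc) (initOf-++-lastOf x ws))
                      (map-++ suc (initOf x ws) (lastOf x ws ∷ []))))
    ; perm        = subst (_↭ oneTo n) (sym σξ) (↭-oneTo-1∷map-suc (x ∷ ws) (↭-oneTo-∷ʳ (x ∷ ws) p))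
    ; cyclic      = begin
        cyclicJumps (σ n ξ)                 ≡⟨ cong cyclicJumps (trans σξ (sym wrapped)) ⟩
        cyclicJumps (map wrap (n ∷ x ∷ ws)) ≡⟨ cyclicJumps-map jump-wrap (n ∷ x ∷ ws) ⟩
        cyclicJumps (n ∷ x ∷ ws)            ≡⟨ rotate-cyclicJumps x ws n ⟨
        rotate (cyclicJumps ξ)              ∎
    ; parityShift = cong par (trans (+-identityʳ _) (trans (cong inversions σξ)
                      (inversions-1∷map-suc n (x ∷ ws) (All.map (λ b → <⇒≤ (proj₂ b)) bounds))))
    }
    where
    open ≡-Reasoning
    ξ = x ∷ ws ++ n ∷ []
    bounds : All (λ a → 0 < a × a < n) (x ∷ ws)
    bounds = All-resp-↭ (↭-sym (↭-oneTo-∷ʳ (x ∷ ws) p)) (all-oneTo n')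
    σξ : σ n ξ ≡ 1 ∷ map suc (x ∷ ws)
    σξ = σ-max-last x ws (<⇒≢ (proj₂ (All.head bounds)))
    wrapped : map wrap (n ∷ x ∷ ws) ≡ 1 ∷ map suc (x ∷ ws)
    wrapped = cong₂ _∷_ wrap-n (map-wrap-< (All.map proj₂ bounds))

  Partial-step : ∀ {ξ s j} → suc j + s ≤ n' → Partial ξ s j → Partial ξ s (suc j)
  Partial-step {ξ} {s} {j} h P = record
    { middle      = map wrap middle
    ; shape       = trans σℓ (trans (cong (map wrap) shape) (trans (map-++ wrap (suc j ∷ middle) (suc j + s ∷ []))
                      (cong₂ (λ a b → a ∷ map wrap middle ++ b ∷ []) (wrap-≢ first≢n) (wrap-≢ last≢n))))
    ; perm        = subst (_↭ oneTo n) (sym σℓ) (↭-wrap perm)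
    ; cyclic      = trans (cong cyclicJumps σℓ) (trans (cyclicJumps-map jump-wrap ℓ) cyclic)
    ; parityShift = begin
        par (inversions (σ n ℓ) + suc j)        ≡⟨ cong (λ xs → par (inversions xs + suc j)) σℓ ⟩
        par (inversions (map wrap ℓ) + suc j)   ≡⟨ cong par (+-suc (inversions (map wrap ℓ)) j) ⟩
        par (suc (inversions (map wrap ℓ)) + j) ≡⟨ par-+-cong {suc (inversions (map wrap ℓ))} {inversions ℓ} {j} {j} (inversions-wrap ℓ perm) refl ⟩
        par (inversions ℓ + j)                  ≡⟨ parityShift ⟩
        par (inversions ξ)                      ∎
    }
    where
    open Partial P
    open ≡-Reasoning
    ℓ = iter (σ n) (suc j) ξ
    first≢n : suc j ≢ n
    first≢n = <⇒≢ (s≤s (≤-trans (m≤m+n (suc j) s) h))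
    last≢n : suc j + s ≢ n
    last≢n = <⇒≢ (s≤s h)
    σℓ : σ n ℓ ≡ map wrap ℓ
    σℓ = σ-wrap shape first≢n last≢n

  σ-run : ∀ x ws → x ∷ ws ++ n ∷ [] ↭ oneTo n → ∀ j → j + lastOf x ws ≤ n' →
    Partial (x ∷ ws ++ n ∷ []) (lastOf x ws) j
  σ-run x ws p zero    _ = Partial-start x ws p
  σ-run x ws p (suc j) h = Partial-step h (σ-run x ws p j (≤-trans (n≤1+n _) h))

  τ-step : ∀ {ξ} → Anchored ξ →
    Anchored (τ n ξ) × cyclicJumps (τ n ξ) ≡ rotate (cyclicJumps ξ)
    × par (inversions (τ n ξ) + suc (secondLast ξ)) ≡ par (inversions ξ)
  τ-step (anchored x ws p) rewrite secondLast-∷ʳ x ws n = subst Step (sym τ-as-run)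
    ( anchored-≡ (trans shape (cong (λ l → suc d ∷ middle ++ suc l ∷ []) (m∸n+n≡m s≤n'))) perm
    , cyclic
    , (begin
      par (I + suc s)           ≡⟨ par-+-double (I + suc s) d ⟨
      par (I + suc s + d * 2)   ≡⟨ cong par (regroup I s d) ⟩
      par (I + d + suc (d + s)) ≡⟨ cong (λ l → par (I + d + suc l)) (m∸n+n≡m s≤n') ⟩
      par (I + d + n)           ≡⟨ par-+-even (I + d) n n-even ⟩
      par (I + d)               ≡⟨ parityShift ⟩
      par (inversions ξ)        ∎))
    where
    open ≡-Reasoning
    ξ = x ∷ ws ++ n ∷ []
    s = lastOf x ws
    d = n' ∸ s
    Step : List ℕ → Set
    Step ℓ = Anchored ℓ × cyclicJumps ℓ ≡ rotate (cyclicJumps ξ) × par (inversions ℓ + suc s) ≡ par (inversions ξ)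
    s≤n' : s ≤ n'
    s≤n' = s≤s⁻¹ (proj₂ (All-lastOf x ws (All-resp-↭ (↭-sym (↭-oneTo-∷ʳ (x ∷ ws) p)) (all-oneTo n'))))
    τ-as-run : iter (σ n) (n ∸ s) ξ ≡ iter (σ n) (suc d) ξ
    τ-as-run = cong (λ k → iter (σ n) k ξ) (+-∸-assoc 1 s≤n')
    open Partial (σ-run x ws p d (≤-reflexive (m∸n+n≡m s≤n')))
    I = inversions (iter (σ n) (suc d) ξ)
    regroup : ∀ I s d → I + suc s + d * 2 ≡ I + d + suc (d + s)
    regroup = solve-∀

  τ-anchored : ∀ {ξ} → Anchored ξ → Anchored (τ n ξ)
  τ-anchored a = proj₁ (τ-step a)

  τ-cyclicJumps : ∀ {ξ} → Anchored ξ → cyclicJumps (τ n ξ) ≡ rotate (cyclicJumps ξ)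
  τ-cyclicJumps a = proj₁ (proj₂ (τ-step a))

  τ-parity : ∀ {ξ} → Anchored ξ → par (inversions (τ n ξ) + suc (secondLast ξ)) ≡ par (inversions ξ)
  τ-parity a = proj₂ (proj₂ (τ-step a))

  τ^-anchored : ∀ {ξ} → Anchored ξ → ∀ k → Anchored (τ^ n k ξ)
  τ^-anchored a zero    = a
  τ^-anchored a (suc k) = τ-anchored (τ^-anchored a k)

  τ-Block : ∀ {ξ w r} → Anchored ξ → Block w (suc r) (cyclicJumps ξ) → Block 1 r (cyclicJumps (τ n ξ))
  τ-Block a B = subst (Block 1 _) (sym (τ-cyclicJumps a)) (rotate-Block B)

  τ^-Block : ∀ {ξ w m} → Anchored ξ → Block w m (cyclicJumps ξ) →
    ∀ k → k < m → Block 1 (m ∸ suc k) (cyclicJumps (τ^ n (suc k) ξ))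
  τ^-Block a B zero    0<m = τ-Block a (Block-resp-≡ (∸-suc 0<m) B)
  τ^-Block a B (suc k) k<m = τ-Block (τ^-anchored a (suc k))
    (Block-resp-≡ (∸-suc k<m) (τ^-Block a B k (≤-trans (n≤1+n _) k<m)))

  cyclicJumps-anchored : ∀ x ws →
    cyclicJumps (x ∷ ws ++ n ∷ []) ≡ par x ∷ par (lastOf x ws) ∷ reverse (jumps (x ∷ ws))
  cyclicJumps-anchored x ws = trans (cyclicJumps-∷ʳ x ws n)
    (cong₂ (λ a b → a ∷ b ∷ reverse (jumps (x ∷ ws)))
      (trans (jump-comm n x) (par-+-even x n n-even)) (par-+-even (lastOf x ws) n n-even))

  firstEntry-par : ∀ {ξ y t} → Anchored ξ → cyclicJumps ξ ≡ y ∷ t → FirstEntry (λ a → par a ≡ y) ξ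
  firstEntry-par (anchored x ws _) e = ∷-injectiveˡ (trans (sym (cyclicJumps-anchored x ws)) e)

  secondLast-par : ∀ {ξ y z t} → Anchored ξ → cyclicJumps ξ ≡ y ∷ z ∷ t → par (secondLast ξ) ≡ z
  secondLast-par (anchored x ws _) e rewrite secondLast-∷ʳ x ws n =
    ∷-injectiveˡ (∷-injectiveʳ (trans (sym (cyclicJumps-anchored x ws)) e))

  τ-preserves-parity : ∀ {ξ w r} → Anchored ξ → Block w (suc r) (cyclicJumps ξ) → parity (τ n ξ) ≡ parity ξ
  τ-preserves-parity {ξ} a (_ , e) = trans
    (sym (par-+-even I (suc (secondLast ξ)) (par-suc {secondLast ξ} {1} (secondLast-par a e))))
    (τ-parity a)
    where I = inversions (τ n ξ)

  τ-flips-parity : ∀ {ξ w} → Anchored ξ → Block w 0 (cyclicJumps ξ) → parity (τ n ξ) ≢ parity ξ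
  τ-flips-parity {ξ} a (_ , e) eq = par-+-odd I (suc (secondLast ξ))
    (par-suc {secondLast ξ} {0} (secondLast-par a e)) (trans (τ-parity a) (sym eq))
    where I = inversions (τ n ξ)

  τ-firstEntry-even : ∀ {ξ w} → Anchored ξ → Block w 0 (cyclicJumps ξ) → FirstEntry Even (τ n ξ)
  τ-firstEntry-even a (_ , e) = firstEntry-par (τ-anchored a) (trans (τ-cyclicJumps a) (cong rotate e))

  τ^-Block-≤ : ∀ {ξ w m} → Anchored ξ → Block w m (cyclicJumps ξ) →
    ∀ k → k ≤ m → ∃ λ y → Block y (m ∸ k) (cyclicJumps (τ^ n k ξ))
  τ^-Block-≤ _ B zero    _   = _ , B
  τ^-Block-≤ a B (suc k) k<m = 1 , τ^-Block a B k k<m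

  τ^-preserves-parity : ∀ {ξ w m} → Anchored ξ → Block w m (cyclicJumps ξ) →
    ∀ k → k ≤ m → parity (τ^ n k ξ) ≡ parity ξ
  τ^-preserves-parity a B zero    _   = refl
  τ^-preserves-parity a B (suc k) k<m = trans
    (τ-preserves-parity (τ^-anchored a k) (Block-resp-≡ (∸-suc k<m) (proj₂ (τ^-Block-≤ a B k (<⇒≤ k<m)))))
    (τ^-preserves-parity a B k (<⇒≤ k<m))

  τ^-flips-parity : ∀ {ξ w m} → Anchored ξ → Block w m (cyclicJumps ξ) →
    parity (τ^ n (suc m) ξ) ≢ parity ξ × FirstEntry Even (τ^ n (suc m) ξ)
  τ^-flips-parity {ξ} {m = m} a B =
    (λ eq → τ-flips-parity (τ^-anchored a m) final (trans eq (sym (τ^-preserves-parity a B m ≤-refl)))) ,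
    τ-firstEntry-even (τ^-anchored a m) final
    where
    final : Block (proj₁ (τ^-Block-≤ a B m ≤-refl)) 0 (cyclicJumps (τ^ n m ξ))
    final = Block-resp-≡ (n∸n≡0 m) (proj₂ (τ^-Block-≤ a B m ≤-refl))

jumps-PAP : ∀ b q → PAP (b ∷ q) → jumps (b ∷ q) ≡ ones (length q)
jumps-PAP b []      _          = refl
jumps-PAP b (c ∷ q) (b≢c , pap) = cong₂ _∷_ (jump-differ b c b≢c) (jumps-PAP c q pap)

cyclicJumps-PAP-suffix : ∀ p a q → PAP q → ¬ PAP (a ∷ q) →
  ∃ λ w → Block w (length q ∸ 1) (cyclicJumps (p ++ a ∷ q))
cyclicJumps-PAP-suffix p a []      _   ¬pap = ⊥-elim (¬pap _)
cyclicJumps-PAP-suffix p a (b ∷ q) pap ¬pap with par a ≟ par b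
... | no a≢b  = ⊥-elim (¬pap (a≢b , pap))
... | yes a≡b with cyclicJumps-++ p a (b ∷ q)
... | w , e = w , reverse D , trans e (cong (w ∷_) reversed)
  where
  open ≡-Reasoning
  D = jumps (p ++ a ∷ [])
  reversed : reverse (jumps (p ++ a ∷ b ∷ q)) ≡ ones (length q) ++ 0 ∷ reverse D
  reversed = begin
    reverse (jumps (p ++ a ∷ b ∷ q))              ≡⟨ cong reverse (jumps-++ p a (b ∷ q)) ⟩
    reverse (D ++ jump a b ∷ jumps (b ∷ q))       ≡⟨ cong (λ j → reverse (D ++ j)) (cong₂ _∷_ (jump-same a b a≡b) (jumps-PAP b q pap)) ⟩
    reverse (D ++ 0 ∷ ones (length q))            ≡⟨ reverse-++ D (0 ∷ ones (length q)) ⟩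
    reverse (0 ∷ ones (length q)) ++ reverse D    ≡⟨ cong (_++ reverse D) (unfold-reverse 0 (ones (length q))) ⟩
    (reverse (ones (length q)) ++ 0 ∷ []) ++ reverse D ≡⟨ cong (λ o → (o ++ 0 ∷ []) ++ reverse D) (reverse-ones (length q)) ⟩
    (ones (length q) ++ 0 ∷ []) ++ reverse D      ≡⟨ ++-assoc (ones (length q)) (0 ∷ []) (reverse D) ⟩
    ones (length q) ++ 0 ∷ reverse D              ∎

block-drop : ∀ {n} xs j → length xs ≡ n → block xs j n ≡ drop j xs
block-drop xs j len = take-all _ (drop j xs) (≤-reflexive (trans (length-drop j xs) (cong (_∸ j) len)))

drop-∷ : ∀ j (xs : List ℕ) → j < length xs → ∃ λ a → drop j xs ≡ a ∷ drop (suc j) xs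
drop-∷ zero    (x ∷ xs) _         = x , refl
drop-∷ (suc j) (x ∷ xs) (s≤s j<l) = drop-∷ j xs j<l

cyclicJumps-maximalPAP : ∀ {n i} ξ → length ξ ≡ n → ¬ PAP ξ → MaximalPAP ξ i n →
  ∃ λ w → Block w (n ∸ i ∸ 1) (cyclicJumps ξ)
cyclicJumps-maximalPAP {i = zero} ξ len ¬pap (_ , _ , pap , _) = ⊥-elim (¬pap (subst PAP (block-drop ξ 0 len) pap))
cyclicJumps-maximalPAP {n} {suc i} ξ len ¬pap (i<n , _ , pap , leftMax , _)
  with drop-∷ i ξ (subst (i <_) (sym len) (≤-trans (n≤1+n _) i<n))
... | a , drop-i
  with cyclicJumps-PAP-suffix (take i ξ) a (drop (suc i) ξ) (subst PAP (block-drop ξ (suc i) len) pap)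
         (λ p → leftMax (s≤s z≤n) (subst PAP (sym (trans (block-drop ξ i len) drop-i)) p))
... | w , B = w , subst (λ xs → Block w (n ∸ suc i ∸ 1) (cyclicJumps xs)) split
                    (Block-resp-≡ (cong (_∸ 1) length-suffix) B)
  where
  split : take i ξ ++ a ∷ drop (suc i) ξ ≡ ξ
  split = trans (cong (take i ξ ++_) (sym drop-i)) (take++drop≡id i ξ)
  length-suffix : length (drop (suc i) ξ) ≡ n ∸ suc i
  length-suffix = trans (length-drop (suc i) ξ) (cong (_∸ suc i) len)

lemma1 : (n i : ℕ) (ξ : List ℕ)
    → 0 < n → n % 2 ≡ 0
    → ξ ↭ map suc (upTo n)
    → last ξ ≡ just n
    → ¬ ParityAlternating ξ
    → MaximalPAP ξ i n
    → ((k : ℕ) → k ≤ n ∸ i ∸ 1 → parity (τ^ n k ξ) ≡ parity ξ)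
      × ((k : ℕ) → 1 ≤ k → k ≤ n ∸ i ∸ 1 → FirstEntry Odd (τ^ n k ξ))
      × (parity (τ^ n (n ∸ i) ξ) ≢ parity ξ)
      × FirstEntry Even (τ^ n (n ∸ i) ξ)
lemma1 (suc n') i ξ _ n-even ξ↭ ξ-last ¬alt maxPAP@(i<n , _) =
  τ^-preserves-parity ξ⁺ B ,
  (λ { (suc k) _ k<m → firstEntry-par (τ^-anchored ξ⁺ (suc k)) (proj₂ (τ^-Block ξ⁺ B k k<m)) }) ,
  subst (λ k → parity (τ^ n k ξ) ≢ parity ξ × FirstEntry Even (τ^ n k ξ)) (sym n∸i) (τ^-flips-parity ξ⁺ B)
  where
  open Orbit n' n-even
  ξ⁺ : Anchored ξ
  ξ⁺ = anchored-last ξ↭ ξ-last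
  start : ∃ λ w → Block w (n ∸ i ∸ 1) (cyclicJumps ξ)
  start = cyclicJumps-maximalPAP ξ (trans (↭-length ξ↭) (length-oneTo n)) ¬alt maxPAP
  B : Block (proj₁ start) (n ∸ i ∸ 1) (cyclicJumps ξ)
  B = proj₂ start
  n∸i : n ∸ i ≡ suc (n ∸ i ∸ 1)
  n∸i = trans (∸-suc i<n) (cong suc (trans (cong (n ∸_) (+-comm 1 i)) (sym (∸-+-assoc n i 1))))
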